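{- Let $\Sigma$ be a finite connected graph of diameter $d$ whose subdivision graph $\mathsf{S}(\Sigma)$ has diameter $D\leq 2d+1$. If $\mathsf{S}(\Sigma)$ is locally $(G,2d)$-distance transitive for some $G\leq \mathrm{Aut}(\Sigma)$, then $\Sigma$ and its line graph $L(\Sigma)$ are both $G$-distance transitive.
   Context: The subdivision graph $\mathsf{S}(\Sigma)$ has vertex set $V\Sigma\cup E\Sigma$ and edges $\{x,e\}$ with $x\in e$; $\mathrm{Aut}(\Sigma)$ acts on it naturally. The line graph $L(\Sigma)$ has vertex set $E\Sigma$, two edges adjacent iff they share a vertex. $\Gamma_i(x)$ is the set of vertices at distance $i$ from $x$. $\Gamma$ is locally $(G,s)$-distance transitive if for every vertex $x$, $G_x$ is transitive on $\Gamma_i(x)$ for all $1\le i\le s$. $\Gamma$ is $G$-distance transitive if $G$ is transitive on vertices and, for each vertex $x$, $G_x$ is transitive on $\Gamma_i(x)$ for every $1\le i\le \mathrm{diam}(\Gamma)$. -}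

module Defs where

open import Data.Nat as ℕ using (ℕ; zero; suc; _≤_; _<_; _+_; _*_)
open import Data.Fin using (Fin; toℕ)
open import Data.Fin.Permutation using (Permutation′; _⟨$⟩ʳ_; id; flip; _∘ₚ_)
open import Data.Bool using (Bool; true; false; T; _∧_)
open import Data.Product using (Σ; ∃; ∃-syntax; _×_; _,_; proj₁; proj₂)
open import Data.Sum using (_⊎_; inj₁; inj₂)
open import Data.Empty using (⊥)
open import Relation.Nullary using (¬_)
open import Relation.Binary.PropositionalEquality using (_≡_; _≢_)

data Walk {V : Set} (_~_ : V → V → Set) : V → V → ℕ → Set where
  here : ∀ {x} → Walk _~_ x x zero
  step : ∀ {x y z k} → x ~ y → Walk _~_ y z k → Walk _~_ x z (suc k)

Dist : {V : Set} (_~_ : V → V → Set) → V → V → ℕ → Set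
Dist _~_ x y k = Walk _~_ x y k × (∀ j → j < k → ¬ Walk _~_ x y j)

Connected : {V : Set} (_~_ : V → V → Set) → Set
Connected {V} _~_ = ∀ (x y : V) → ∃[ k ] Walk _~_ x y k

HasDiameter : {V : Set} (_~_ : V → V → Set) → ℕ → Set
HasDiameter {V} _~_ d =
  (∀ (x y : V) → ∃[ k ] (k ≤ d × Walk _~_ x y k))
  × (Σ V λ x → Σ V λ y → Dist _~_ x y d)

-- Group actions: a set of group elements Grp (given as a predicate on a
-- type of group elements), and a relation  Sends g x y  meaning  x^g = y.

StabTransitive : {V Elt : Set} (_~_ : V → V → Set) (G : Elt → Set)
  (Sends : Elt → V → V → Set) → V → ℕ → Set
StabTransitive _~_ G Sends x i =
  ∀ y z → Dist _~_ x y i → Dist _~_ x z i →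
  Σ _ λ g → G g × Sends g x x × Sends g y z

LocallyDistTransitive : {V Elt : Set} (_~_ : V → V → Set) (G : Elt → Set)
  (Sends : Elt → V → V → Set) → ℕ → Set
LocallyDistTransitive {V} _~_ G Sends s =
  ∀ (x : V) (i : ℕ) → 1 ≤ i → i ≤ s → StabTransitive _~_ G Sends x i

DistTransitive : {V Elt : Set} (_~_ : V → V → Set) (G : Elt → Set)
  (Sends : Elt → V → V → Set) → Set
DistTransitive {V} _~_ G Sends =
  (∀ (x y : V) → Σ _ λ g → G g × Sends g x y)
  × (∀ (x : V) (i : ℕ) → 1 ≤ i → StabTransitive _~_ G Sends x i)

record FinGraph : Set where
  field
    n     : ℕ
    adj   : Fin n → Fin n → Bool
    sym   : ∀ i j → adj i j ≡ adj j i
    irrefl : ∀ i → adj i i ≡ false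

module _ (Γ : FinGraph) where
  open FinGraph Γ

  Vtx : Set
  Vtx = Fin n

  _~_ : Vtx → Vtx → Set
  i ~ j = T (adj i j)

  -- an edge {i , j} represented canonically by the pair (i , j) with i < j
  Edge : Set
  Edge = Σ (Fin n × Fin n) λ p → T ((toℕ (proj₁ p) ℕ.<ᵇ toℕ (proj₂ p)) ∧ adj (proj₁ p) (proj₂ p))

  _∈ₑ_ : Vtx → Edge → Set
  x ∈ₑ ((i , j) , _) = x ≡ i ⊎ x ≡ j

  _~L_ : Edge → Edge → Set
  e ~L f = proj₁ e ≢ proj₁ f × ∃[ x ] (x ∈ₑ e × x ∈ₑ f)

  _~S_ : Vtx ⊎ Edge → Vtx ⊎ Edge → Set
  inj₁ x ~S inj₂ e = x ∈ₑ e
  inj₂ e ~S inj₁ x = x ∈ₑ e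
  inj₁ _ ~S inj₁ _ = ⊥
  inj₂ _ ~S inj₂ _ = ⊥

  IsAut : Permutation′ n → Set
  IsAut g = ∀ i j → adj (g ⟨$⟩ʳ i) (g ⟨$⟩ʳ j) ≡ adj i j

  record IsSubgroupOfAut (G : Permutation′ n → Set) : Set where
    field
      aut  : ∀ g → G g → IsAut g
      one  : G id
      mul  : ∀ g h → G g → G h → G (g ∘ₚ h)
      inv  : ∀ g → G g → G (flip g)

  SendsV : Permutation′ n → Vtx → Vtx → Set
  SendsV g x y = g ⟨$⟩ʳ x ≡ y

  SendsE : Permutation′ n → Edge → Edge → Set
  SendsE g ((i , j) , _) ((k , l) , _) =
    (g ⟨$⟩ʳ i ≡ k × g ⟨$⟩ʳ j ≡ l) ⊎ (g ⟨$⟩ʳ i ≡ l × g ⟨$⟩ʳ j ≡ k)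

  SendsS : Permutation′ n → Vtx ⊎ Edge → Vtx ⊎ Edge → Set
  SendsS g (inj₁ x) (inj₁ y) = SendsV g x y
  SendsS g (inj₂ e) (inj₂ f) = SendsE g e f
  SendsS g (inj₁ _) (inj₂ _) = ⊥
  SendsS g (inj₂ _) (inj₁ _) = ⊥

-- A walk in Σ (or in L(Σ)) of length k becomes a walk of length 2k in S(Σ) by
-- passing through the edges (resp. vertices) it uses, and conversely a walk of
-- length k in S(Σ) between two vertices (resp. two edges) of Σ contracts to one
-- of length at most k/2. Hence distances double: Γᵢ(x) in Σ, resp. Γᵢ(e) in
-- L(Σ), is Γ₂ᵢ(x) ∩ VΣ, resp. Γ₂ᵢ(e) ∩ EΣ, in S(Σ). Distances in Σ are at most
-- d, and distances in L(Σ) are at most d because 2i ≤ D ≤ 2d + 1; so local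
-- (G,2d)-distance transitivity of S(Σ) gives transitivity of every G_x on every
-- Γᵢ(x). Transitivity of G on VΣ and on EΣ follows from local 1-transitivity
-- of the connected graph S(Σ): stepping twice along a walk stays in one orbit.
module Submission where

open import Defs
open import Data.Nat using (ℕ; _≤_; _+_; _*_)
open import Data.Fin.Permutation using (Permutation′)
open import Data.Product using (_×_)

open import Data.Nat using (zero; suc; _<_; z≤n; s≤s; s≤s⁻¹)
open import Data.Nat.Properties
open import Data.Fin using (toℕ)
open import Data.Fin.Properties using (toℕ-injective) renaming (_≟_ to _≟ᶠ_)
open import Data.Fin.Permutation using (_∘ₚ_) renaming (id to idₚ)
open import Data.Bool using (T)
open import Data.Bool.Properties using (T-∧; T-irrelevant)
open import Data.Product using (Σ; ∃-syntax; _,_; proj₁; proj₂)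
open import Data.Product.Properties using (≡-dec)
open import Data.Sum using (_⊎_; inj₁; inj₂)
open import Data.Empty using (⊥-elim)
open import Relation.Nullary using (¬_; yes; no)
open import Relation.Binary using (tri<; tri≈; tri>)
open import Relation.Binary.PropositionalEquality
open import Function.Bundles using (Equivalence)

*-double-suc-mono : ∀ {j k} → 2 * j ≤ k → 2 * suc j ≤ suc (suc k)
*-double-suc-mono {j} le rewrite *-suc 2 j = s≤s (s≤s le)

*-double≤1+*-double⇒≤ : ∀ {j d} → 2 * j ≤ 2 * d + 1 → j ≤ d
*-double≤1+*-double⇒≤ {j} {d} le = s≤s⁻¹ (*-cancelˡ-< 2 j (suc d) (begin-strict
  2 * j       ≤⟨ le ⟩
  2 * d + 1   ≡⟨ +-comm (2 * d) 1 ⟩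
  suc (2 * d) <⟨ n<1+n _ ⟩
  2 + 2 * d   ≡⟨ *-suc 2 d ⟨
  2 * suc d   ∎))
  where open ≤-Reasoning

module _ {V : Set} {_~_ : V → V → Set} where

  Dist⇒≤walk : ∀ {x y i k} → Dist _~_ x y i → Walk _~_ x y k → i ≤ k
  Dist⇒≤walk (_ , shortest) w = ≮⇒≥ (λ k<i → shortest _ k<i w)

  Dist⇒≤diameter : ∀ {d x y i} → HasDiameter _~_ d → Dist _~_ x y i → i ≤ d
  Dist⇒≤diameter {x = x} {y} (bounded , _) dist with bounded x y
  ... | k , k≤d , w = ≤-trans (Dist⇒≤walk dist w) k≤d

  adjacent⇒Dist1 : (∀ x → ¬ x ~ x) → ∀ {x y} → x ~ y → Dist _~_ x y 1
  adjacent⇒Dist1 irrefl {x} x~y = step x~y here , shorter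
    where
      shorter : ∀ j → j < 1 → ¬ Walk _~_ x _ j
      shorter zero _ here = irrefl x x~y
      shorter (suc _) (s≤s ()) _

  adjacent⇒1≤diameter : (∀ x → ¬ x ~ x) → ∀ {d x y} → HasDiameter _~_ d → x ~ y → 1 ≤ d
  adjacent⇒1≤diameter irrefl diam x~y = Dist⇒≤diameter diam (adjacent⇒Dist1 irrefl x~y)

Dist-double : {U W : Set} {_~U_ : U → U → Set} {_~W_ : W → W → Set} {a b : U} {a′ b′ : W}
  → (∀ {k} → Walk _~U_ a b k → Walk _~W_ a′ b′ (2 * k))
  → (∀ {k} → Walk _~W_ a′ b′ k → ∃[ j ] (2 * j ≤ k × Walk _~U_ a b j))
  → ∀ {i} → Dist _~U_ a b i → Dist _~W_ a′ b′ (2 * i)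
Dist-double double halve {i} (w , shortest) = double w , shorter
  where
    shorter : ∀ k → k < 2 * i → ¬ Walk _ _ _ k
    shorter k k<2i w′ with halve w′
    ... | j , 2j≤k , u = shortest j (*-cancelˡ-< 2 j i (≤-<-trans 2j≤k k<2i)) u

InOrbit : {V Elt : Set} → (Elt → Set) → (Elt → V → V → Set) → V → V → Set
InOrbit G Sends x y = Σ _ λ g → G g × Sends g x y

module LocalTransitivity {V Elt : Set} (_~_ : V → V → Set) (G : Elt → Set)
  (Sends : Elt → V → V → Set)
  (e : Elt) (G-e : G e) (Sends-e : ∀ x → Sends e x x)
  (_·_ : Elt → Elt → Elt) (G-· : ∀ {g h} → G g → G h → G (g · h))
  (Sends-· : ∀ {g h x y z} → Sends g x y → Sends h y z → Sends (g · h) x z)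
  (~-sym : ∀ {x y} → x ~ y → y ~ x) (~-irrefl : ∀ x → ¬ x ~ x)
  (local : ∀ {x y} → x ~ y → StabTransitive _~_ G Sends x 1)
  where

  -- The stabiliser of a neighbour y of x carries x to any other neighbour of
  -- y, so two consecutive steps of a walk stay inside one G-orbit.
  walk⇒InOrbit⊎adjacentInOrbit : ∀ {x z k} → Walk _~_ x z k →
    InOrbit G Sends x z ⊎ (Σ V λ w → x ~ w × InOrbit G Sends w z)
  walk⇒InOrbit⊎adjacentInOrbit {x} here = inj₁ (e , G-e , Sends-e x)
  walk⇒InOrbit⊎adjacentInOrbit {x} (step {y = y} x~y w) with walk⇒InOrbit⊎adjacentInOrbit w
  ... | inj₁ y∈zᴳ = inj₂ (y , x~y , y∈zᴳ)
  ... | inj₂ (w′ , y~w′ , g , Gg , g:w′↦z)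
    with local (~-sym x~y) x w′ (adjacent⇒Dist1 ~-irrefl (~-sym x~y)) (adjacent⇒Dist1 ~-irrefl y~w′)
  ... | h , Gh , _ , h:x↦w′ = inj₁ (h · g , G-· Gh Gg , Sends-· h:x↦w′ g:w′↦z)

module _ (Γ : FinGraph) where
  open FinGraph Γ using (n; adj; irrefl)

  private
    E = Edge Γ
    _∼_ = _~_ Γ
    _∼S_ = _~S_ Γ
    _∼L_ = _~L_ Γ
    _∈e_ = _∈ₑ_ Γ

  ∼-irrefl : ∀ x → ¬ x ∼ x
  ∼-irrefl x x∼x rewrite irrefl x = x∼x

  ∼S-irrefl : ∀ u → ¬ u ∼S u
  ∼S-irrefl (inj₁ _) ()
  ∼S-irrefl (inj₂ _) ()

  ∼S-sym : ∀ {u w} → u ∼S w → w ∼S u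
  ∼S-sym {inj₁ _} {inj₂ _} u∼w = u∼w
  ∼S-sym {inj₂ _} {inj₁ _} u∼w = u∼w

  edge-adjacent : (e : E) → proj₁ (proj₁ e) ∼ proj₂ (proj₁ e)
  edge-adjacent (_ , p) = proj₂ (Equivalence.to T-∧ p)

  edge-≡ : (e f : E) → proj₁ e ≡ proj₁ f → e ≡ f
  edge-≡ (a , p) (.a , q) refl = cong (a ,_) (T-irrelevant p q)

  joiningEdge : ∀ {x y} → x ∼ y → Σ E λ e → x ∈e e × y ∈e e
  joiningEdge {x} {y} x∼y with <-cmp (toℕ x) (toℕ y)
  ... | tri< x<y _ _ = ((x , y) , Equivalence.from T-∧ (<⇒<ᵇ x<y , x∼y)) , inj₁ refl , inj₂ refl
  ... | tri≈ _ x≡y _ = ⊥-elim (∼-irrefl y (subst (_∼ y) (toℕ-injective x≡y) x∼y))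
  ... | tri> _ _ y<x =
    ((y , x) , Equivalence.from T-∧ (<⇒<ᵇ y<x , subst T (FinGraph.sym Γ x y) x∼y)) , inj₂ refl , inj₁ refl

  distinctEnds⇒∼ : ∀ {x y} (e : E) → x ∈e e → y ∈e e → x ≢ y → x ∼ y
  distinctEnds⇒∼ e (inj₁ refl) (inj₁ refl) x≢y = ⊥-elim (x≢y refl)
  distinctEnds⇒∼ e (inj₁ refl) (inj₂ refl) x≢y = edge-adjacent e
  distinctEnds⇒∼ ((i , j) , p) (inj₂ refl) (inj₁ refl) x≢y =
    subst T (FinGraph.sym Γ i j) (edge-adjacent ((i , j) , p))
  distinctEnds⇒∼ e (inj₂ refl) (inj₂ refl) x≢y = ⊥-elim (x≢y refl)

  subdivide : ∀ {x y k} → Walk _∼_ x y k → Walk _∼S_ (inj₁ x) (inj₁ y) (2 * k)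
  subdivide here = here
  subdivide {k = suc k} (step x∼y w) with joiningEdge x∼y
  ... | e , x∈e , y∈e rewrite *-suc 2 k = step {y = inj₂ e} x∈e (step y∈e (subdivide w))

  -- A detour x, e, x through an edge is dropped rather than contracted.
  contract : ∀ {x y k} → Walk _∼S_ (inj₁ x) (inj₁ y) k → ∃[ j ] (2 * j ≤ k × Walk _∼_ x y j)
  contract here = 0 , z≤n , here
  contract {x} (step {y = inj₂ e} x∈e (step {y = inj₁ y} y∈e w)) with contract w | x ≟ᶠ y
  ... | j , le , w′ | yes refl = j , ≤-trans le (m≤n+m _ 2) , w′
  ... | j , le , w′ | no x≢y = suc j , *-double-suc-mono le , step (distinctEnds⇒∼ e x∈e y∈e x≢y) w′

  subdivideL : ∀ {e f k} → Walk _∼L_ e f k → Walk _∼S_ (inj₂ e) (inj₂ f) (2 * k)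
  subdivideL here = here
  subdivideL {k = suc k} (step (_ , x , x∈e , x∈f) w) rewrite *-suc 2 k =
    step {y = inj₁ x} x∈e (step x∈f (subdivideL w))

  contractL : ∀ {e f k} → Walk _∼S_ (inj₂ e) (inj₂ f) k → ∃[ j ] (2 * j ≤ k × Walk _∼L_ e f j)
  contractL here = 0 , z≤n , here
  contractL {e} (step {y = inj₁ x} x∈e (step {y = inj₂ e′} x∈e′ w))
    with contractL w | ≡-dec _≟ᶠ_ _≟ᶠ_ (proj₁ e) (proj₁ e′)
  ... | j , le , w′ | yes ends≡ rewrite edge-≡ e e′ ends≡ = j , ≤-trans le (m≤n+m _ 2) , w′
  ... | j , le , w′ | no ends≢ = suc j , *-double-suc-mono le , step (ends≢ , x , x∈e , x∈e′) w′

  Dist-subdivide : ∀ {x y i} → Dist _∼_ x y i → Dist _∼S_ (inj₁ x) (inj₁ y) (2 * i)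
  Dist-subdivide = Dist-double subdivide contract

  Dist-subdivideL : ∀ {e f i} → Dist _∼L_ e f i → Dist _∼S_ (inj₂ e) (inj₂ f) (2 * i)
  Dist-subdivideL = Dist-double subdivideL contractL

  SendsS-id : ∀ u → SendsS Γ idₚ u u
  SendsS-id (inj₁ x) = refl
  SendsS-id (inj₂ e) = inj₁ (refl , refl)

  SendsS-∘ : ∀ {g h u w v} → SendsS Γ g u w → SendsS Γ h w v → SendsS Γ (g ∘ₚ h) u v
  SendsS-∘ {u = inj₁ _} {inj₁ _} {inj₁ _} refl refl = refl
  SendsS-∘ {u = inj₂ _} {inj₂ _} {inj₂ _} (inj₁ (refl , refl)) (inj₁ (refl , refl)) = inj₁ (refl , refl)
  SendsS-∘ {u = inj₂ _} {inj₂ _} {inj₂ _} (inj₁ (refl , refl)) (inj₂ (refl , refl)) = inj₂ (refl , refl)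
  SendsS-∘ {u = inj₂ _} {inj₂ _} {inj₂ _} (inj₂ (refl , refl)) (inj₁ (refl , refl)) = inj₂ (refl , refl)
  SendsS-∘ {u = inj₂ _} {inj₂ _} {inj₂ _} (inj₂ (refl , refl)) (inj₂ (refl , refl)) = inj₁ (refl , refl)

  module SubdivisionOrbits (G : Permutation′ n → Set) (sub : IsSubgroupOfAut Γ G)
    (local : ∀ {u w} → u ∼S w → StabTransitive _∼S_ G (SendsS Γ) u 1) where
    open IsSubgroupOfAut sub using (one; mul)
    open LocalTransitivity _∼S_ G (SendsS Γ) idₚ one SendsS-id _∘ₚ_ (mul _ _)
      SendsS-∘ ∼S-sym ∼S-irrefl local

    -- A neighbour of a vertex is an edge, never in the orbit of a vertex (and dually).
    walk⇒InOrbitV : ∀ {x y k} → Walk _∼S_ (inj₁ x) (inj₁ y) k → InOrbit G (SendsV Γ) x y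
    walk⇒InOrbitV w with walk⇒InOrbit⊎adjacentInOrbit w
    ... | inj₁ x∈yᴳ = x∈yᴳ
    ... | inj₂ (inj₂ _ , _ , _ , _ , ())

    walk⇒InOrbitE : ∀ {e f k} → Walk _∼S_ (inj₂ e) (inj₂ f) k → InOrbit G (SendsE Γ) e f
    walk⇒InOrbitE w with walk⇒InOrbit⊎adjacentInOrbit w
    ... | inj₁ e∈fᴳ = e∈fᴳ
    ... | inj₂ (inj₁ _ , _ , _ , _ , ())

lemma2p1 : (Γ : FinGraph) (d D : ℕ) (G : Permutation′ (FinGraph.n Γ) → Set)
    → Connected (_~_ Γ) → HasDiameter (_~_ Γ) d
    → HasDiameter (_~S_ Γ) D → D ≤ 2 * d + 1
    → IsSubgroupOfAut Γ G
    → LocallyDistTransitive (_~S_ Γ) G (SendsS Γ) (2 * d)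
    → DistTransitive (_~_ Γ) G (SendsV Γ) × DistTransitive (_~L_ Γ) G (SendsE Γ)
-- Connectivity is unused: the diameter hypotheses already provide all walks.
lemma2p1 Γ d D G _ diamΣ diamS D≤2d+1 sub ldt =
  ((λ x y → walk⇒InOrbitV (walkS (inj₁ x) (inj₁ y))) , stabV) ,
  ((λ e f → walk⇒InOrbitE (walkS (inj₂ e) (inj₂ f))) , stabL)
  where
    walkS : ∀ u v → Walk (_~S_ Γ) u v (proj₁ (proj₁ diamS u v))
    walkS u v = proj₂ (proj₂ (proj₁ diamS u v))

    1≤d : ∀ {u w} → _~S_ Γ u w → 1 ≤ d
    1≤d {inj₁ _} {inj₂ e} _ = adjacent⇒1≤diameter (∼-irrefl Γ) diamΣ (edge-adjacent Γ e)
    1≤d {inj₂ e} {inj₁ _} _ = adjacent⇒1≤diameter (∼-irrefl Γ) diamΣ (edge-adjacent Γ e)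

    open SubdivisionOrbits Γ G sub (λ u∼w → ldt _ 1 ≤-refl (≤-trans (1≤d u∼w) (m≤n*m d 2)))

    stabV : ∀ x i → 1 ≤ i → StabTransitive (_~_ Γ) G (SendsV Γ) x i
    stabV x i 1≤i y z dy dz = ldt (inj₁ x) (2 * i) (≤-trans 1≤i (m≤n*m i 2))
      (*-monoʳ-≤ 2 (Dist⇒≤diameter diamΣ dy)) (inj₁ y) (inj₁ z) (Dist-subdivide Γ dy) (Dist-subdivide Γ dz)

    stabL : ∀ e i → 1 ≤ i → StabTransitive (_~L_ Γ) G (SendsE Γ) e i
    stabL e i 1≤i f f′ df df′ = ldt (inj₂ e) (2 * i) (≤-trans 1≤i (m≤n*m i 2))
      (*-monoʳ-≤ 2 i≤d) (inj₂ f) (inj₂ f′) (Dist-subdivideL Γ df) (Dist-subdivideL Γ df′)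
      where
        i≤d : i ≤ d
        i≤d = *-double≤1+*-double⇒≤ (≤-trans (Dist⇒≤diameter diamS (Dist-subdivideL Γ df)) D≤2d+1)
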